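{- Let $D$ be a $k$-fold circuit in a matroid $\mathcal{M}$ and let $A_i$ be a part of the principal partition of $D$. Then for every circuit $C\subseteq D$ of $\mathcal{M}$, either $C\cap A_i=\emptyset$ or $A_i\subseteq C$.
   Context: Matroids have finite ground sets, rank $r$. A cyclic set is a set $D$ with $r(D-e)=r(D)$ for all $e\in D$; a $k$-fold circuit is a cyclic set with $r(D)=|D|-k$. The principal partition of a $k$-fold circuit $D$ is $\{D\setminus B: B\subseteq D\text{ a }(k-1)\text{ -fold circuit}\}$, which is a partition of $D$. -}

module Defs where

open import Data.Nat using (ℕ; _+_; _≤_; _<_)
open import Data.Fin using (Fin)
open import Data.Fin.Subset using (Subset; _⊆_; _⊂_; _∪_; _∩_; _─_; _-_; _∈_; ∣_∣)
open import Data.Product using (_×_; Σ)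
open import Relation.Binary.PropositionalEquality using (_≡_)
open import Relation.Nullary using (¬_)

record Matroid (n : ℕ) : Set where
  field
    r          : Subset n → ℕ
    r-bounded  : ∀ X → r X ≤ ∣ X ∣
    r-mono     : ∀ {X Y} → X ⊆ Y → r X ≤ r Y
    r-submod   : ∀ X Y → r (X ∪ Y) + r (X ∩ Y) ≤ r X + r Y

module _ {n : ℕ} (M : Matroid n) where
  open Matroid M

  Independent : Subset n → Set
  Independent X = r X ≡ ∣ X ∣

  IsCircuit : Subset n → Set
  IsCircuit C = ¬ Independent C × (∀ Y → Y ⊂ C → Independent Y)

  Cyclic : Subset n → Set
  Cyclic D = ∀ e → e ∈ D → r (D - e) ≡ r D

  -- k-fold circuit: cyclic with r(D) = |D| - k  (stated as r(D) + k = |D|)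
  IsKFoldCircuit : ℕ → Subset n → Set
  IsKFoldCircuit k D = Cyclic D × (r D + k ≡ ∣ D ∣)

  -- A is a part of the principal partition of the k-fold circuit D:
  -- A = D ∖ B for some (k-1)-fold circuit B ⊆ D   (k = suc j, B a j-fold circuit)
  IsPrincipalPart : ℕ → Subset n → Subset n → Set
  IsPrincipalPart j D A =
    Σ (Subset n) λ B → B ⊆ D × IsKFoldCircuit j B × (A ≡ D ─ B)

{-# OPTIONS --safe #-}
-- Write A = D ∖ B with B a (k-1)-fold circuit; then r(D) = r(B) + |A| - 1.
-- Suppose a circuit C ⊆ D meets A in f but misses e ∈ A. Since D is cyclic,
-- e is redundant in D; since C is a circuit, f is redundant in C, and C - f
-- lies in B ∪ (A - f). Removing both, D is spanned by B ∪ (A - {e, f}), so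
-- r(D) ≤ r(B) + |A| - 2, a contradiction.
module Submission where

open import Defs
open import Data.Nat using (ℕ; suc)
open import Data.Fin.Subset using (Subset; _⊆_; _∩_; Empty)
open import Data.Sum using (_⊎_)

open import Data.Empty using (⊥-elim)
open import Data.Fin using (Fin)
open import Data.Fin.Properties using (_≟_)
open import Data.Fin.Subset using (_∪_; _─_; _-_; _∈_; _∉_; ∣_∣; ⁅_⁆; inside; outside)
open import Data.Fin.Subset.Properties
  using ( _∈?_; nonempty?; p⊆q⇒∣p∣≤∣q∣; ∣p∩q∣≤∣q∣; ∣⁅x⁆∣≡1; x∉⁅y⁆⇒x≢y
        ; x∈p∪q⁺; x∈p∪q⁻; x∈p∩q⁺; x∈p∩q⁻; p─q⊆p
        ; x∈p∧x∉q⇒x∈p─q; x∈p∧x≢y⇒x∈p-y; x∈p⇒p-x⊂p; x∈p⇒∣p-x∣<∣p∣ )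
open import Data.Nat using (_+_; _≤_; s≤s; s≤s⁻¹)
open import Data.Nat.Properties
  using ( +-suc; +-assoc; +-comm; +-cancelʳ-≡; +-cancelʳ-≤; +-monoˡ-≤; +-monoʳ-≤
        ; m≤m+n; ≤-trans; ≤-reflexive; ≤-antisym; ≤∧≢⇒<; 1+n≰n; module ≤-Reasoning )
open import Data.Product using (_,_; proj₁; proj₂)
open import Data.Sum using (inj₁; inj₂)
open import Data.Vec using (_∷_; []; there)
open import Function using (_∘_)
open import Relation.Binary.PropositionalEquality using (_≡_; _≢_; refl; sym; cong; module ≡-Reasoning)
open import Relation.Nullary using (yes; no)

private
  variable
    n : ℕ
    p q : Subset n
    x y : Fin n

x∈p─q⇒x∉q : x ∈ p ─ q → x ∉ q
x∈p─q⇒x∉q {p = _ ∷ _} {q = outside ∷ _} (there x∈p─q) (there x∈q) = x∈p─q⇒x∉q x∈p─q x∈q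
x∈p─q⇒x∉q {p = _ ∷ _} {q = inside  ∷ _} (there x∈p─q) (there x∈q) = x∈p─q⇒x∉q x∈p─q x∈q

x∈p-y⇒x≢y : x ∈ p - y → x ≢ y
x∈p-y⇒x≢y = x∉⁅y⁆⇒x≢y ∘ x∈p─q⇒x∉q

∣p∣≡∣p∩q∣+∣p─q∣ : ∀ (p q : Subset n) → ∣ p ∣ ≡ ∣ p ∩ q ∣ + ∣ p ─ q ∣
∣p∣≡∣p∩q∣+∣p─q∣ []            []            = refl
∣p∣≡∣p∩q∣+∣p─q∣ (inside  ∷ p) (inside  ∷ q) = cong suc (∣p∣≡∣p∩q∣+∣p─q∣ p q)
∣p∣≡∣p∩q∣+∣p─q∣ (inside  ∷ p) (outside ∷ q) = begin
  suc ∣ p ∣                       ≡⟨ cong suc (∣p∣≡∣p∩q∣+∣p─q∣ p q) ⟩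
  suc (∣ p ∩ q ∣ + ∣ p ─ q ∣)     ≡⟨ +-suc ∣ p ∩ q ∣ ∣ p ─ q ∣ ⟨
  ∣ p ∩ q ∣ + suc ∣ p ─ q ∣       ∎
  where open ≡-Reasoning
∣p∣≡∣p∩q∣+∣p─q∣ (outside ∷ p) (inside  ∷ q) = ∣p∣≡∣p∩q∣+∣p─q∣ p q
∣p∣≡∣p∩q∣+∣p─q∣ (outside ∷ p) (outside ∷ q) = ∣p∣≡∣p∩q∣+∣p─q∣ p q

∣p∣≤1+∣p-x∣ : ∀ (p : Subset n) x → ∣ p ∣ ≤ suc ∣ p - x ∣
∣p∣≤1+∣p-x∣ p x = begin
  ∣ p ∣                       ≡⟨ ∣p∣≡∣p∩q∣+∣p─q∣ p ⁅ x ⁆ ⟩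
  ∣ p ∩ ⁅ x ⁆ ∣ + ∣ p - x ∣   ≤⟨ +-monoˡ-≤ ∣ p - x ∣ (∣p∩q∣≤∣q∣ p ⁅ x ⁆) ⟩
  ∣ ⁅ x ⁆ ∣ + ∣ p - x ∣       ≡⟨ cong (_+ ∣ p - x ∣) (∣⁅x⁆∣≡1 x) ⟩
  suc ∣ p - x ∣               ∎
  where open ≤-Reasoning

q⊆p⇒∣p∩q∣≡∣q∣ : ∀ {p q : Subset n} → q ⊆ p → ∣ p ∩ q ∣ ≡ ∣ q ∣
q⊆p⇒∣p∩q∣≡∣q∣ {p = p} {q = q} q⊆p =
  ≤-antisym (∣p∩q∣≤∣q∣ p q) (p⊆q⇒∣p∣≤∣q∣ (λ x∈q → x∈p∩q⁺ (q⊆p x∈q , x∈q)))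

module _ (M : Matroid n) where
  open Matroid M

  r-∪-≤ : ∀ X Y → r (X ∪ Y) ≤ r X + ∣ Y ∣
  r-∪-≤ X Y = begin
    r (X ∪ Y)                 ≤⟨ m≤m+n (r (X ∪ Y)) (r (X ∩ Y)) ⟩
    r (X ∪ Y) + r (X ∩ Y)     ≤⟨ r-submod X Y ⟩
    r X + r Y                 ≤⟨ +-monoʳ-≤ (r X) (r-bounded Y) ⟩
    r X + ∣ Y ∣               ∎
    where open ≤-Reasoning

  r-∪-absorbs : ∀ {X Y Z} → Z ⊆ Y → Z ⊆ X → r X ≤ r Z → r (Y ∪ X) ≤ r Y
  r-∪-absorbs {X} {Y} {Z} Z⊆Y Z⊆X rX≤rZ = +-cancelʳ-≤ (r (Y ∩ X)) (r (Y ∪ X)) (r Y) (begin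
    r (Y ∪ X) + r (Y ∩ X)     ≤⟨ r-submod Y X ⟩
    r Y + r X                 ≤⟨ +-monoʳ-≤ (r Y) (≤-trans rX≤rZ (r-mono Z⊆Y∩X)) ⟩
    r Y + r (Y ∩ X)           ∎)
    where
    open ≤-Reasoning
    Z⊆Y∩X : Z ⊆ Y ∩ X
    Z⊆Y∩X z∈Z = x∈p∩q⁺ (Z⊆Y z∈Z , Z⊆X z∈Z)

  circuit⇒cyclic : ∀ {C} → IsCircuit M C → Cyclic M C
  circuit⇒cyclic {C} (dependent , minimal) e e∈C =
    ≤-antisym (r-mono (p─q⊆p C ⁅ e ⁆)) (begin
      r C               ≤⟨ s≤s⁻¹ (≤-trans (≤∧≢⇒< (r-bounded C) dependent) (∣p∣≤1+∣p-x∣ C e)) ⟩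
      ∣ C - e ∣         ≡⟨ minimal (C - e) (x∈p⇒p-x⊂p e∈C) ⟨
      r (C - e)         ∎)
    where open ≤-Reasoning

  cyclic-r-∪-< : ∀ {Z S T e} → Cyclic M Z → e ∈ Z → e ∈ T → Z ⊆ S ∪ T →
                 suc (r (S ∪ T)) ≤ r S + ∣ T ∣
  cyclic-r-∪-< {Z} {S} {T} {e} cyclic e∈Z e∈T Z⊆S∪T = begin
    suc (r (S ∪ T))               ≤⟨ s≤s (r-mono S∪T⊆S∪[T-e]∪Z) ⟩
    suc (r ((S ∪ (T - e)) ∪ Z))   ≤⟨ s≤s (r-∪-absorbs Z-e⊆S∪[T-e] (p─q⊆p Z ⁅ e ⁆) rZ≤rZ-e) ⟩
    suc (r (S ∪ (T - e)))         ≤⟨ s≤s (r-∪-≤ S (T - e)) ⟩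
    suc (r S + ∣ T - e ∣)         ≡⟨ +-suc (r S) ∣ T - e ∣ ⟨
    r S + suc ∣ T - e ∣           ≤⟨ +-monoʳ-≤ (r S) (x∈p⇒∣p-x∣<∣p∣ e∈T) ⟩
    r S + ∣ T ∣                   ∎
    where
    open ≤-Reasoning
    rZ≤rZ-e : r Z ≤ r (Z - e)
    rZ≤rZ-e = ≤-reflexive (sym (cyclic e e∈Z))
    S∪T⊆S∪[T-e]∪Z : S ∪ T ⊆ (S ∪ (T - e)) ∪ Z
    S∪T⊆S∪[T-e]∪Z {x} x∈S∪T with x∈p∪q⁻ S T x∈S∪T | x ≟ e
    ... | inj₁ x∈S | _       = x∈p∪q⁺ (inj₁ (x∈p∪q⁺ (inj₁ x∈S)))
    ... | inj₂ x∈T | yes refl = x∈p∪q⁺ (inj₂ e∈Z)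
    ... | inj₂ x∈T | no x≢e   = x∈p∪q⁺ (inj₁ (x∈p∪q⁺ (inj₂ (x∈p∧x≢y⇒x∈p-y x∈T x≢e))))
    Z-e⊆S∪[T-e] : Z - e ⊆ S ∪ (T - e)
    Z-e⊆S∪[T-e] x∈Z-e with x∈p∪q⁻ S T (Z⊆S∪T (p─q⊆p Z ⁅ e ⁆ x∈Z-e))
    ... | inj₁ x∈S = x∈p∪q⁺ (inj₁ x∈S)
    ... | inj₂ x∈T = x∈p∪q⁺ (inj₂ (x∈p∧x≢y⇒x∈p-y x∈T (x∈p-y⇒x≢y x∈Z-e)))

  principal-part-rank : ∀ {D B j} → r D + suc j ≡ ∣ D ∣ → B ⊆ D → r B + j ≡ ∣ B ∣ →
                        suc (r D) ≡ r B + ∣ D ─ B ∣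
  principal-part-rank {D} {B} {j} rD B⊆D rB = +-cancelʳ-≡ j (suc (r D)) (r B + ∣ A ∣) (begin
    suc (r D) + j             ≡⟨ +-suc (r D) j ⟨
    r D + suc j               ≡⟨ rD ⟩
    ∣ D ∣                     ≡⟨ ∣p∣≡∣p∩q∣+∣p─q∣ D B ⟩
    ∣ D ∩ B ∣ + ∣ A ∣         ≡⟨ cong (_+ ∣ A ∣) (q⊆p⇒∣p∩q∣≡∣q∣ B⊆D) ⟩
    ∣ B ∣ + ∣ A ∣             ≡⟨ cong (_+ ∣ A ∣) rB ⟨
    r B + j + ∣ A ∣           ≡⟨ +-assoc (r B) j ∣ A ∣ ⟩
    r B + (j + ∣ A ∣)         ≡⟨ cong (r B +_) (+-comm j ∣ A ∣) ⟩
    r B + (∣ A ∣ + j)         ≡⟨ +-assoc (r B) ∣ A ∣ j ⟨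
    r B + ∣ A ∣ + j           ∎)
    where
    open ≡-Reasoning
    A = D ─ B

  principal-part-rank-gap : ∀ {D B C e f} → Cyclic M D → IsCircuit M C → C ⊆ D →
                            e ∈ D ─ B → e ∉ C → f ∈ D ─ B → f ∈ C →
                            suc (suc (r D)) ≤ r B + ∣ D ─ B ∣
  principal-part-rank-gap {D} {B} {C} {e} {f} cyclicD circuitC C⊆D e∈A e∉C f∈A f∈C = begin
    suc (suc (r D))                       ≤⟨ s≤s (s≤s (r-mono D⊆B∪X∪[A─C])) ⟩
    suc (suc (r ((B ∪ X) ∪ (A ─ C))))     ≤⟨ s≤s e-redundant ⟩
    suc (r (B ∪ X)) + ∣ A ─ C ∣           ≤⟨ +-monoˡ-≤ ∣ A ─ C ∣ f-redundant ⟩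
    r B + ∣ X ∣ + ∣ A ─ C ∣               ≡⟨ +-assoc (r B) ∣ X ∣ ∣ A ─ C ∣ ⟩
    r B + (∣ X ∣ + ∣ A ─ C ∣)             ≡⟨ cong (r B +_) (∣p∣≡∣p∩q∣+∣p─q∣ A C) ⟨
    r B + ∣ A ∣                           ∎
    where
    open ≤-Reasoning
    A = D ─ B
    X = A ∩ C
    D⊆B∪X∪[A─C] : D ⊆ (B ∪ X) ∪ (A ─ C)
    D⊆B∪X∪[A─C] {x} x∈D with x ∈? B | x ∈? C
    ... | yes x∈B | _       = x∈p∪q⁺ (inj₁ (x∈p∪q⁺ (inj₁ x∈B)))
    ... | no x∉B  | yes x∈C = x∈p∪q⁺ (inj₁ (x∈p∪q⁺ (inj₂ (x∈p∩q⁺ (x∈p∧x∉q⇒x∈p─q x∈D x∉B , x∈C)))))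
    ... | no x∉B  | no x∉C  = x∈p∪q⁺ (inj₂ (x∈p∧x∉q⇒x∈p─q (x∈p∧x∉q⇒x∈p─q x∈D x∉B) x∉C))
    C⊆B∪X : C ⊆ B ∪ X
    C⊆B∪X {x} x∈C with x ∈? B
    ... | yes x∈B = x∈p∪q⁺ (inj₁ x∈B)
    ... | no x∉B  = x∈p∪q⁺ (inj₂ (x∈p∩q⁺ (x∈p∧x∉q⇒x∈p─q (C⊆D x∈C) x∉B , x∈C)))
    e-redundant : suc (r ((B ∪ X) ∪ (A ─ C))) ≤ r (B ∪ X) + ∣ A ─ C ∣
    e-redundant = cyclic-r-∪-< cyclicD (p─q⊆p D B e∈A) (x∈p∧x∉q⇒x∈p─q e∈A e∉C) D⊆B∪X∪[A─C]
    f-redundant : suc (r (B ∪ X)) ≤ r B + ∣ X ∣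
    f-redundant = cyclic-r-∪-< (circuit⇒cyclic circuitC) f∈C (x∈p∩q⁺ (f∈A , f∈C)) C⊆B∪X

  principal-part-⊆-circuit : ∀ {D B C f j} → IsKFoldCircuit M (suc j) D →
                             B ⊆ D → r B + j ≡ ∣ B ∣ → IsCircuit M C → C ⊆ D →
                             f ∈ C ∩ (D ─ B) → D ─ B ⊆ C
  principal-part-⊆-circuit {D} {B} {C} (cyclicD , rD) B⊆D rB circuitC C⊆D f∈C∩A {x} x∈A
    with x ∈? C
  ... | yes x∈C = x∈C
  ... | no x∉C  = ⊥-elim (1+n≰n (begin
    suc (suc (r D))           ≤⟨ principal-part-rank-gap cyclicD circuitC C⊆D x∈A x∉C f∈A f∈C ⟩
    r B + ∣ D ─ B ∣           ≡⟨ principal-part-rank rD B⊆D rB ⟨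
    suc (r D)                 ∎))
    where
    open ≤-Reasoning
    f∈C = proj₁ (x∈p∩q⁻ C (D ─ B) f∈C∩A)
    f∈A = proj₂ (x∈p∩q⁻ C (D ─ B) f∈C∩A)

mainTheorem15 : ∀ {n : ℕ} (M : Matroid n) (j : ℕ) (D A C : Subset n) →
    IsKFoldCircuit M (suc j) D →
    IsPrincipalPart M j D A →
    IsCircuit M C → C ⊆ D →
    Empty (C ∩ A) ⊎ A ⊆ C
mainTheorem15 M j D .(D ─ B) C D-fold (B , B⊆D , (_ , rB) , refl) circuitC C⊆D
  with nonempty? (C ∩ (D ─ B))
... | no  C∩A-empty     = inj₁ C∩A-empty
... | yes (f , f∈C∩A)   = inj₂ (principal-part-⊆-circuit M D-fold B⊆D rB circuitC C⊆D f∈C∩A)
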